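{- There exists an encoding of Left-Leaning AVL trees using at most $0.5912n+o(n)$ bits for Left-Leaning AVL trees with $n$ nodes. That is, there are maps $E_n$, $n\geq 1$, where $E_n$ is an injective map from the set of Left-Leaning AVL trees with $n$ nodes to finite binary strings, such that the maximum length of $E_n(T)$ over all Left-Leaning AVL trees $T$ with $n$ nodes is at most $0.5912\,n+o(n)$ as $n\to\infty$.
   Context: A binary tree is a rooted tree in which every node has at most one left child and at most one right child. The height of a tree is the number of edges on a longest path from the root to a leaf, and the empty tree has height $-1$. An AVL tree is a binary tree in which, at every node, the subtrees rooted at the left and right children (either of which may be empty) have heights differing by at most $1$. A Left-Leaning AVL tree is an AVL tree in which, at every node, the height of the left subtree is at least the height of the right subtree. -}

module Defs where

open import Data.Nat using (ℕ; suc; _+_)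
open import Data.Integer using (ℤ; -1ℤ; 1ℤ; _⊔_; _-_; ∣_∣) renaming (_+_ to _+ℤ_; _≤_ to _≤ℤ_)
import Data.Nat as ℕ
open import Data.Unit using (⊤)
open import Data.Product using (Σ; _×_)
open import Relation.Binary.PropositionalEquality using (_≡_)

data Tree : Set where
  empty : Tree
  node  : Tree → Tree → Tree

size : Tree → ℕ
size empty = 0
size (node l r) = suc (size l + size r)

height : Tree → ℤ
height empty = -1ℤ
height (node l r) = 1ℤ +ℤ (height l ⊔ height r)

IsAVL : Tree → Set
IsAVL empty = ⊤
IsAVL (node l r) = IsAVL l × IsAVL r × ∣ height l - height r ∣ ℕ.≤ 1

IsLeftLeaning : Tree → Set
IsLeftLeaning empty = ⊤
IsLeftLeaning (node l r) = IsLeftLeaning l × IsLeftLeaning r × height r ≤ℤ height l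

IsLLAVL : Tree → Set
IsLLAVL t = IsAVL t × IsLeftLeaning t

LLAVL : ℕ → Set
LLAVL n = Σ Tree (λ t → size t ≡ n × IsLLAVL t)

{-# OPTIONS --safe #-}

-- Give a tree with n nodes the weight (2/3)^n. The total weight a_k of the Left-Leaning AVL
-- trees of height k − 1 satisfies a_(k+2) = (2/3)·a_(k+1)·(a_(k+1) + a_k), because the left
-- subtree of such a tree has height k and the right one height k or k − 1. From k = 6 on the
-- a_k decay geometrically with ratio 4/5, so all Left-Leaning AVL trees together weigh at
-- most 8. Hence there are at most 8·(3/2)^n of them with n nodes, and the position of a tree
-- in a list of these, written in binary, has at most 3 + n·log₂(3/2) < 3 + 0.585·n bits.
module Submission where

open import Defs
open import Data.Nat using (ℕ; zero; suc; _≟_)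
open import Data.List using (List; []; _∷_; [_]; _++_; map; filter; length; cartesianProductWith)
open import Data.List.Membership.Propositional using (_∈_)
open import Data.Product using (Σ; _×_; _,_; ∃; proj₁)
open import Function using (_∘_)
open import Relation.Binary.PropositionalEquality
  using (_≡_; refl; sym; trans; cong; cong₂; subst; subst₂; module ≡-Reasoning)

module Enumeration where
  open import Data.Nat using (_+_; _∸_; _≤_; _<_; z≤n; s≤s)
  import Data.Nat.Properties as ℕ
  open import Data.Integer as ℤ using (ℤ; +_; -1ℤ; 1ℤ; ∣_∣) renaming (_+_ to _+ℤ_; _≤_ to _≤ℤ_)
  import Data.Integer.Properties as ℤ
  open import Data.List.Membership.Propositional.Properties
    using (∈-++⁺ˡ; ∈-++⁺ʳ; ∈-cartesianProductWith⁺; ∈-filter⁺)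
  open import Data.List.Relation.Unary.Any using (here)
  open import Data.Sum using (inj₁; inj₂)

  -- Rank k stands for height k − 1, so that ranks are natural numbers.
  heightOfRank : ℕ → ℤ
  heightOfRank zero    = -1ℤ
  heightOfRank (suc k) = + k

  1+heightOfRank : ∀ k → 1ℤ +ℤ heightOfRank k ≡ + k
  1+heightOfRank zero    = refl
  1+heightOfRank (suc k) = refl

  heightOfRank-cancel-≤ : ∀ {a b} → heightOfRank b ≤ℤ heightOfRank a → b ≤ a
  heightOfRank-cancel-≤ {a}     {zero}  _ = z≤n
  heightOfRank-cancel-≤ {suc a} {suc b} p = s≤s (ℤ.drop‿+≤+ p)

  heightOfRank-balanced : ∀ {a b} → b ≤ a → ∣ heightOfRank a ℤ.- heightOfRank b ∣ ≤ 1 → a ≤ suc b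
  heightOfRank-balanced {zero}  {zero}  _         _ = z≤n
  heightOfRank-balanced {suc a} {zero}  _         p = subst (_≤ 1) (ℕ.+-comm a 1) p
  heightOfRank-balanced {suc a} {suc b} (s≤s b≤a) p = s≤s (begin
    a            ≤⟨ ℕ.m≤n+m∸n a b ⟩
    b + (a ∸ b)  ≤⟨ ℕ.+-monoʳ-≤ b a∸b≤1 ⟩
    b + 1        ≡⟨ ℕ.+-comm b 1 ⟩
    suc b        ∎)
    where
    open ℕ.≤-Reasoning
    a∸b≤1 : a ∸ b ≤ 1
    a∸b≤1 = subst (_≤ 1) (cong ∣_∣ (trans (ℤ.m-n≡m⊖n a b) (ℤ.⊖-≥ b≤a))) p

  llavlOfRank : ℕ → List Tree
  llavlOfRank zero          = [ empty ]
  llavlOfRank (suc zero)    = [ node empty empty ]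
  llavlOfRank (suc (suc k)) =
    cartesianProductWith node (llavlOfRank (suc k)) (llavlOfRank (suc k) ++ llavlOfRank k)

  node-∈-llavlOfRank : ∀ {l r a b} → l ∈ llavlOfRank a → r ∈ llavlOfRank b →
                       b ≤ a → a ≤ suc b → node l r ∈ llavlOfRank (suc a)
  node-∈-llavlOfRank {a = zero}  {zero}  (here refl) (here refl) _ _ = here refl
  node-∈-llavlOfRank {a = suc a} {b} l∈ r∈ b≤a a≤1+b with ℕ.m≤n⇒m<n∨m≡n b≤a
  ... | inj₂ refl = ∈-cartesianProductWith⁺ node l∈ (∈-++⁺ˡ r∈)
  ... | inj₁ b<1+a with ℕ.≤-antisym (ℕ.≤-pred b<1+a) (ℕ.≤-pred a≤1+b)
  ...   | refl = ∈-cartesianProductWith⁺ node l∈ (∈-++⁺ʳ (llavlOfRank (suc a)) r∈)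

  llavlOfRank-complete : ∀ t → IsLLAVL t →
                         Σ ℕ λ k → height t ≡ heightOfRank k × k ≤ size t × t ∈ llavlOfRank k
  llavlOfRank-complete empty _ = 0 , refl , z≤n , here refl
  llavlOfRank-complete (node l r) ((avlˡ , avlʳ , balanced) , (leanˡ , leanʳ , leans))
    with llavlOfRank-complete l (avlˡ , leanˡ) | llavlOfRank-complete r (avlʳ , leanʳ)
  ... | a , hˡ , a≤ , l∈ | b , hʳ , _ , r∈ =
    suc a , height≡ , s≤s (ℕ.m≤n⇒m≤n+o _ a≤) , node-∈-llavlOfRank l∈ r∈ b≤a a≤1+b
    where
    b≤a : b ≤ a
    b≤a = heightOfRank-cancel-≤ (subst₂ _≤ℤ_ hʳ hˡ leans)
    a≤1+b : a ≤ suc b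
    a≤1+b = heightOfRank-balanced b≤a (subst₂ (λ p q → ∣ p ℤ.- q ∣ ≤ 1) hˡ hʳ balanced)
    height≡ : 1ℤ +ℤ (height l ℤ.⊔ height r) ≡ + a
    height≡ = trans (cong (1ℤ +ℤ_) (trans (ℤ.i≥j⇒i⊔j≡i leans) hˡ)) (1+heightOfRank a)

  llavlOfRankBelow : ℕ → List Tree
  llavlOfRankBelow zero    = []
  llavlOfRankBelow (suc m) = llavlOfRankBelow m ++ llavlOfRank m

  ∈-llavlOfRankBelow : ∀ {t k m} → t ∈ llavlOfRank k → k < m → t ∈ llavlOfRankBelow m
  ∈-llavlOfRankBelow {m = suc m} t∈ (s≤s k≤m) with ℕ.m≤n⇒m<n∨m≡n k≤m
  ... | inj₁ k<m  = ∈-++⁺ˡ (∈-llavlOfRankBelow t∈ k<m)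
  ... | inj₂ refl = ∈-++⁺ʳ (llavlOfRankBelow m) t∈

  withSize : ℕ → List Tree → List Tree
  withSize n = filter (λ t → size t ≟ n)

  llavlOfSize : ℕ → List Tree
  llavlOfSize n = withSize n (llavlOfRankBelow (suc n))

  ∈-llavlOfSize : ∀ {n t} → size t ≡ n → IsLLAVL t → t ∈ llavlOfSize n
  ∈-llavlOfSize {n} {t} refl llavl with llavlOfRank-complete t llavl
  ... | k , _ , k≤size , t∈ =
    ∈-filter⁺ (λ u → size u ≟ n) (∈-llavlOfRankBelow t∈ (s≤s k≤size)) refl

open Enumeration

module QuadraticRecurrence where

  import Data.Nat as ℕ
  import Data.Nat.Properties as ℕ
  open import Data.Rational using (ℚ; 0ℚ; 1ℚ; _+_; _*_; _≤_)
  open import Data.Rational.Base using (nonNegative)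
  import Data.Rational.Properties as ℚ
  open import Relation.Nullary.Decidable using (dec⇒maybe)
  open import Tactic.RingSolver.Core.AlmostCommutativeRing using (AlmostCommutativeRing; fromCommutativeRing)
  open import Tactic.RingSolver using (solve-∀)

  ℚ-ring : AlmostCommutativeRing _ _
  ℚ-ring = fromCommutativeRing ℚ.+-*-commutativeRing (λ p → dec⇒maybe (0ℚ ℚ.≟ p))

  0≤p*q : ∀ {p q} → 0ℚ ≤ p → 0ℚ ≤ q → 0ℚ ≤ p * q
  0≤p*q {p} {q} 0≤p 0≤q =
    ℚ.nonNegative⁻¹ (p * q) {{ℚ.nonNeg*nonNeg⇒nonNeg p {{nonNegative 0≤p}} q {{nonNegative 0≤q}}}}

  p≤q+p : ∀ {p q} → 0ℚ ≤ q → p ≤ q + p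
  p≤q+p {p} {q} 0≤q = ℚ.≤-trans (ℚ.≤-reflexive (sym (ℚ.+-identityˡ p))) (ℚ.+-monoˡ-≤ p 0≤q)

  p≤p+q : ∀ {p q} → 0ℚ ≤ q → p ≤ p + q
  p≤p+q {p} {q} 0≤q = ℚ.≤-trans (ℚ.≤-reflexive (sym (ℚ.+-identityʳ p))) (ℚ.+-monoʳ-≤ p 0≤q)

  partialSum : (ℕ → ℚ) → ℕ → ℚ
  partialSum a zero    = 0ℚ
  partialSum a (suc m) = partialSum a m + a m

  partialSum-≤-+ : ∀ {a} → (∀ k → 0ℚ ≤ a k) → ∀ j n → partialSum a n ≤ partialSum a (j ℕ.+ n)
  partialSum-≤-+ 0≤a zero    n = ℚ.≤-refl
  partialSum-≤-+ 0≤a (suc j) n = ℚ.≤-trans (partialSum-≤-+ 0≤a j n) (p≤p+q (0≤a (j ℕ.+ n)))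

  module Contraction {x ρ : ℚ} {a : ℕ → ℚ} (0≤x : 0ℚ ≤ x) (0≤a : ∀ k → 0ℚ ≤ a k)
           (a-rec : ∀ k → a (suc (suc k)) ≡ x * a (suc k) * (a (suc k) + a k))
           (0≤ρ : 0ℚ ≤ ρ) (ρ≤1 : ρ ≤ 1ℚ) where

    open ℚ.≤-Reasoning

    Contracting : ℕ → Set
    Contracting k = a (suc k) ≤ ρ * a k × x * (a (suc k) + a k) ≤ ρ

    contracting-suc : ∀ {k} → Contracting k → Contracting (suc k)
    contracting-suc {k} (a₁≤ρa₀ , x[a₁+a₀]≤ρ) = a₂≤ρa₁ , x[a₂+a₁]≤ρ
      where
      a₀ = a k
      a₁ = a (suc k)
      a₂ = a (suc (suc k))
      reorder : ∀ x p q → x * p * (p + q) ≡ x * (p + q) * p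
      reorder = solve-∀ ℚ-ring
      factor : ∀ x ρ p q → x * (ρ * p + ρ * q) ≡ ρ * (x * (p + q))
      factor = solve-∀ ℚ-ring
      a₂≤ρa₁ : a₂ ≤ ρ * a₁
      a₂≤ρa₁ = begin
        a₂                    ≡⟨ a-rec k ⟩
        x * a₁ * (a₁ + a₀)    ≡⟨ reorder x a₁ a₀ ⟩
        x * (a₁ + a₀) * a₁    ≤⟨ ℚ.*-monoʳ-≤-nonNeg a₁ {{nonNegative (0≤a (suc k))}} x[a₁+a₀]≤ρ ⟩
        ρ * a₁                ∎
      x[a₂+a₁]≤ρ : x * (a₂ + a₁) ≤ ρ
      x[a₂+a₁]≤ρ = begin
        x * (a₂ + a₁)          ≤⟨ ℚ.*-monoˡ-≤-nonNeg x {{nonNegative 0≤x}} (ℚ.+-mono-≤ a₂≤ρa₁ a₁≤ρa₀) ⟩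
        x * (ρ * a₁ + ρ * a₀)  ≡⟨ factor x ρ a₁ a₀ ⟩
        ρ * (x * (a₁ + a₀))    ≤⟨ ℚ.*-monoˡ-≤-nonNeg ρ {{nonNegative 0≤ρ}} (ℚ.≤-trans x[a₁+a₀]≤ρ ρ≤1) ⟩
        ρ * 1ℚ                 ≡⟨ ℚ.*-identityʳ ρ ⟩
        ρ                      ∎

    contracting-+ : ∀ {m} → Contracting m → ∀ j → Contracting (j ℕ.+ m)
    contracting-+ cm zero    = cm
    contracting-+ cm (suc j) = contracting-suc (contracting-+ cm j)

    module _ {c : ℚ} (c≡1+cρ : c ≡ 1ℚ + c * ρ) (0≤c : 0ℚ ≤ c) where

      potential-+ : ∀ {m} → Contracting m → ∀ j →
                    partialSum a (j ℕ.+ m) + c * a (j ℕ.+ m) ≤ partialSum a m + c * a m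
      potential-+ _        zero    = ℚ.≤-refl
      potential-+ {m} cm (suc j) = begin
        s + a₀ + c * a₁           ≤⟨ ℚ.+-monoʳ-≤ (s + a₀) (ℚ.*-monoˡ-≤-nonNeg c {{nonNegative 0≤c}} a₁≤ρa₀) ⟩
        s + a₀ + c * (ρ * a₀)     ≡⟨ collect s a₀ c ρ ⟩
        s + (1ℚ + c * ρ) * a₀     ≡⟨ cong (λ d → s + d * a₀) (sym c≡1+cρ) ⟩
        s + c * a₀                ≤⟨ potential-+ cm j ⟩
        partialSum a m + c * a m  ∎
        where
        s = partialSum a (j ℕ.+ m)
        a₀ = a (j ℕ.+ m)
        a₁ = a (suc (j ℕ.+ m))
        a₁≤ρa₀ : a₁ ≤ ρ * a₀
        a₁≤ρa₀ = proj₁ (contracting-+ cm j)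
        collect : ∀ s p c ρ → s + p + c * (ρ * p) ≡ s + (1ℚ + c * ρ) * p
        collect = solve-∀ ℚ-ring

      partialSum-bounded : ∀ {m} → Contracting m → ∀ n → partialSum a n ≤ partialSum a m + c * a m
      partialSum-bounded {m} cm n = begin
        partialSum a n                            ≤⟨ partialSum-≤-+ 0≤a m n ⟩
        partialSum a (m ℕ.+ n)                    ≡⟨ cong (partialSum a) (ℕ.+-comm m n) ⟩
        partialSum a (n ℕ.+ m)                    ≤⟨ p≤p+q (0≤p*q 0≤c (0≤a (n ℕ.+ m))) ⟩
        partialSum a (n ℕ.+ m) + c * a (n ℕ.+ m)  ≤⟨ potential-+ cm n ⟩
        partialSum a m + c * a m                  ∎

open QuadraticRecurrence

module Counting where

  import Data.Integer as ℤ
  import Data.Nat as ℕ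
  import Data.Nat.Properties as ℕ
  open import Data.Rational using (ℚ; 0ℚ; 1ℚ; _+_; _*_; _≤_; _<_; _/_)
  open import Data.Rational.Base using (nonNegative)
  import Data.Rational.Properties as ℚ
  open import Algebra.Bundles using (CommutativeRing)
  open import Algebra.Properties.CommutativeSemiring.Exp (CommutativeRing.commutativeSemiring ℚ.+-*-commutativeRing)
    using (_^_; ^-homo-*; ^-distrib-*)
  open import Algebra.Properties.Semiring.Mult (CommutativeRing.semiring ℚ.+-*-commutativeRing)
    using (×-assocˡ; ×-assoc-*; ×1-homo-*) renaming (_×_ to _·_)
  open import Data.List.Properties using (filter-accept; filter-reject)
  open import Relation.Nullary using (yes; no)

  fromℕ : ℕ → ℚ
  fromℕ n = n · 1ℚ

  0≤fromℕ : ∀ n → 0ℚ ≤ fromℕ n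
  0≤fromℕ zero    = ℚ.≤-refl
  0≤fromℕ (suc n) = ℚ.+-mono-≤ (ℚ.nonNegative⁻¹ 1ℚ) (0≤fromℕ n)

  fromℕ-mono-< : ∀ {m n} → m ℕ.< n → fromℕ m < fromℕ n
  fromℕ-mono-< {zero}  {suc n} _         = ℚ.+-mono-<-≤ (ℚ.positive⁻¹ 1ℚ) (0≤fromℕ n)
  fromℕ-mono-< {suc m} {suc n} (ℕ.s≤s m<n) = ℚ.+-mono-≤-< (ℚ.≤-refl {1ℚ}) (fromℕ-mono-< m<n)

  fromℕ-cancel-≤ : ∀ {m n} → fromℕ m ≤ fromℕ n → m ℕ.≤ n
  fromℕ-cancel-≤ h = ℕ.≮⇒≥ (λ n<m → ℚ.<-irrefl refl (ℚ.<-≤-trans (fromℕ-mono-< n<m) h))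

  fromℕ-homo-^ : ∀ m n → fromℕ (m ℕ.^ n) ≡ fromℕ m ^ n
  fromℕ-homo-^ m zero    = refl
  fromℕ-homo-^ m (suc n) = trans (×1-homo-* m (m ℕ.^ n)) (cong (fromℕ m *_) (fromℕ-homo-^ m n))

  module Weighted (x : ℚ) where

    open ≡-Reasoning

    weight : Tree → ℚ
    weight t = x ^ size t

    weightSum : List Tree → ℚ
    weightSum []       = 0ℚ
    weightSum (t ∷ ts) = weight t + weightSum ts

    weight-node : ∀ l r → weight (node l r) ≡ x * weight l * weight r
    weight-node l r = trans (cong (x *_) (^-homo-* x (size l) (size r))) (sym (ℚ.*-assoc x _ _))

    weightSum-++ : ∀ ts us → weightSum (ts ++ us) ≡ weightSum ts + weightSum us
    weightSum-++ []       us = sym (ℚ.+-identityˡ _)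
    weightSum-++ (t ∷ ts) us =
      trans (cong (weight t +_) (weightSum-++ ts us)) (sym (ℚ.+-assoc (weight t) (weightSum ts) (weightSum us)))

    weightSum-map-node : ∀ l rs → weightSum (map (node l) rs) ≡ x * weight l * weightSum rs
    weightSum-map-node l []       = sym (ℚ.*-zeroʳ (x * weight l))
    weightSum-map-node l (r ∷ rs) = begin
      weight (node l r) + weightSum (map (node l) rs)
        ≡⟨ cong₂ _+_ (weight-node l r) (weightSum-map-node l rs) ⟩
      x * weight l * weight r + x * weight l * weightSum rs
        ≡⟨ sym (ℚ.*-distribˡ-+ (x * weight l) (weight r) (weightSum rs)) ⟩
      x * weight l * (weight r + weightSum rs) ∎

    weightSum-cartesianProductWith-node : ∀ ls rs →
      weightSum (cartesianProductWith node ls rs) ≡ x * weightSum ls * weightSum rs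
    weightSum-cartesianProductWith-node []       rs =
      sym (trans (cong (_* weightSum rs) (ℚ.*-zeroʳ x)) (ℚ.*-zeroˡ (weightSum rs)))
    weightSum-cartesianProductWith-node (l ∷ ls) rs = begin
      weightSum (map (node l) rs ++ cartesianProductWith node ls rs)
        ≡⟨ weightSum-++ (map (node l) rs) _ ⟩
      weightSum (map (node l) rs) + weightSum (cartesianProductWith node ls rs)
        ≡⟨ cong₂ _+_ (weightSum-map-node l rs) (weightSum-cartesianProductWith-node ls rs) ⟩
      x * weight l * weightSum rs + x * weightSum ls * weightSum rs
        ≡⟨ sym (ℚ.*-distribʳ-+ (weightSum rs) (x * weight l) (x * weightSum ls)) ⟩
      (x * weight l + x * weightSum ls) * weightSum rs
        ≡⟨ cong (_* weightSum rs) (sym (ℚ.*-distribˡ-+ x (weight l) (weightSum ls))) ⟩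
      x * (weight l + weightSum ls) * weightSum rs ∎

    rankWeight : ℕ → ℚ
    rankWeight zero          = 1ℚ
    rankWeight (suc zero)    = x
    rankWeight (suc (suc k)) = x * rankWeight (suc k) * (rankWeight (suc k) + rankWeight k)

    weightSum-llavlOfRank : ∀ k → weightSum (llavlOfRank k) ≡ rankWeight k
    weightSum-llavlOfRank zero          = ℚ.+-identityʳ 1ℚ
    weightSum-llavlOfRank (suc zero)    = trans (ℚ.+-identityʳ _) (ℚ.*-identityʳ x)
    weightSum-llavlOfRank (suc (suc k)) = begin
      weightSum (cartesianProductWith node (llavlOfRank (suc k)) (llavlOfRank (suc k) ++ llavlOfRank k))
        ≡⟨ weightSum-cartesianProductWith-node (llavlOfRank (suc k)) _ ⟩
      x * weightSum (llavlOfRank (suc k)) * weightSum (llavlOfRank (suc k) ++ llavlOfRank k)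
        ≡⟨ cong (x * weightSum (llavlOfRank (suc k)) *_) (weightSum-++ (llavlOfRank (suc k)) _) ⟩
      x * weightSum (llavlOfRank (suc k)) * (weightSum (llavlOfRank (suc k)) + weightSum (llavlOfRank k))
        ≡⟨ cong₂ (λ p q → x * p * (p + q)) (weightSum-llavlOfRank (suc k)) (weightSum-llavlOfRank k) ⟩
      rankWeight (suc (suc k)) ∎

    weightSum-llavlOfRankBelow : ∀ m → weightSum (llavlOfRankBelow m) ≡ partialSum rankWeight m
    weightSum-llavlOfRankBelow zero    = refl
    weightSum-llavlOfRankBelow (suc m) =
      trans (weightSum-++ (llavlOfRankBelow m) (llavlOfRank m))
            (cong₂ _+_ (weightSum-llavlOfRankBelow m) (weightSum-llavlOfRank m))

    module _ (0≤x : 0ℚ ≤ x) where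

      0≤weight : ∀ t → 0ℚ ≤ weight t
      0≤weight t = 0≤x^ (size t)
        where
        0≤x^ : ∀ n → 0ℚ ≤ x ^ n
        0≤x^ zero    = ℚ.nonNegative⁻¹ 1ℚ
        0≤x^ (suc n) = 0≤p*q 0≤x (0≤x^ n)

      0≤weightSum : ∀ ts → 0ℚ ≤ weightSum ts
      0≤weightSum []       = ℚ.≤-refl
      0≤weightSum (t ∷ ts) = ℚ.+-mono-≤ (0≤weight t) (0≤weightSum ts)

      0≤rankWeight : ∀ k → 0ℚ ≤ rankWeight k
      0≤rankWeight k = subst (0ℚ ≤_) (weightSum-llavlOfRank k) (0≤weightSum (llavlOfRank k))

      length-withSize·x^n≤weightSum : ∀ n ts → length (withSize n ts) · x ^ n ≤ weightSum ts
      length-withSize·x^n≤weightSum n [] = ℚ.≤-refl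
      length-withSize·x^n≤weightSum n (t ∷ ts) with size t ≟ n
      ... | yes e rewrite filter-accept (λ u → size u ≟ n) {xs = ts} e =
        ℚ.+-mono-≤ (ℚ.≤-reflexive (cong (x ^_) (sym e))) (length-withSize·x^n≤weightSum n ts)
      ... | no ¬e rewrite filter-reject (λ u → size u ≟ n) {xs = ts} ¬e =
        ℚ.≤-trans (length-withSize·x^n≤weightSum n ts) (p≤q+p (0≤weight t))

  ⅔ ⅘ : ℚ
  ⅔ = ℤ.+ 2 / 3
  ⅘ = ℤ.+ 4 / 5

  open Weighted ⅔

  0≤⅔ : 0ℚ ≤ ⅔
  0≤⅔ = ℚ.≤ᵇ⇒≤ _

  open Contraction {ρ = ⅘} 0≤⅔ (0≤rankWeight 0≤⅔) (λ _ → refl) (ℚ.≤ᵇ⇒≤ _) (ℚ.≤ᵇ⇒≤ _)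

  -- The decay sets in at rank 6; checked by evaluating the exact rationals rankWeight 6 and 7.
  contracting-6 : Contracting 6
  contracting-6 = ℚ.≤ᵇ⇒≤ _ , ℚ.≤ᵇ⇒≤ _

  partialSum-rankWeight≤8 : ∀ n → partialSum rankWeight n ≤ fromℕ 8
  partialSum-rankWeight≤8 n =
    ℚ.≤-trans (partialSum-bounded {c = fromℕ 5} refl (0≤fromℕ 5) {m = 6} contracting-6 n)
              (ℚ.≤ᵇ⇒≤ {partialSum rankWeight 6 + fromℕ 5 * rankWeight 6} _)

  length-llavlOfSize : ∀ n → length (llavlOfSize n) ℕ.* 2 ℕ.^ n ℕ.≤ 8 ℕ.* 3 ℕ.^ n
  length-llavlOfSize n = fromℕ-cancel-≤ (begin
    fromℕ (L ℕ.* 2 ℕ.^ n)           ≡⟨ sym (×-assocˡ 1ℚ L (2 ℕ.^ n)) ⟩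
    L · fromℕ (2 ℕ.^ n)             ≡⟨ cong (L ·_) fromℕ-2^n ⟩
    L · (⅔ ^ n * fromℕ (3 ℕ.^ n))   ≡⟨ sym (×-assoc-* L (⅔ ^ n) _) ⟩
    L · ⅔ ^ n * fromℕ (3 ℕ.^ n)     ≤⟨ ℚ.*-monoʳ-≤-nonNeg _ {{nonNegative (0≤fromℕ (3 ℕ.^ n))}} L·⅔^n≤8 ⟩
    fromℕ 8 * fromℕ (3 ℕ.^ n)       ≡⟨ sym (×1-homo-* 8 (3 ℕ.^ n)) ⟩
    fromℕ (8 ℕ.* 3 ℕ.^ n)           ∎)
    where
    open ℚ.≤-Reasoning
    L = length (llavlOfSize n)
    fromℕ-2^n : fromℕ (2 ℕ.^ n) ≡ ⅔ ^ n * fromℕ (3 ℕ.^ n)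
    fromℕ-2^n = begin-equality
      fromℕ (2 ℕ.^ n)            ≡⟨ fromℕ-homo-^ 2 n ⟩
      (⅔ * fromℕ 3) ^ n          ≡⟨ ^-distrib-* ⅔ (fromℕ 3) n ⟩
      ⅔ ^ n * fromℕ 3 ^ n        ≡⟨ cong (⅔ ^ n *_) (sym (fromℕ-homo-^ 3 n)) ⟩
      ⅔ ^ n * fromℕ (3 ℕ.^ n)    ∎
    L·⅔^n≤8 : L · ⅔ ^ n ≤ fromℕ 8
    L·⅔^n≤8 = begin
      L · ⅔ ^ n
        ≤⟨ length-withSize·x^n≤weightSum 0≤⅔ n (llavlOfRankBelow (suc n)) ⟩
      weightSum (llavlOfRankBelow (suc n))
        ≡⟨ weightSum-llavlOfRankBelow (suc n) ⟩
      partialSum rankWeight (suc n)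
        ≤⟨ partialSum-rankWeight≤8 (suc n) ⟩
      fromℕ 8 ∎

open Counting using (length-llavlOfSize)

module BitStrings where

  open import Data.Nat using (_^_; _≤_; z≤n; s≤s)
  import Data.Nat.Properties as ℕ
  open import Data.Nat.Binary using (ℕᵇ; 2[1+_]; 1+[2_]; toℕ; fromℕ)
  import Data.Nat.Binary as ℕᵇ
  open import Data.Nat.Binary.Properties using (toℕ-fromℕ)
  open import Data.Bool using (Bool; true; false)

  -- ℕᵇ is bijective base-2 numeration (digits 1 and 2), so toBits is a bijection onto all bit strings.
  toBits : ℕᵇ → List Bool
  toBits ℕᵇ.zero   = []
  toBits 2[1+ b ] = true ∷ toBits b
  toBits 1+[2 b ] = false ∷ toBits b

  fromBits : List Bool → ℕᵇ
  fromBits []           = ℕᵇ.zero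
  fromBits (true ∷ bs)  = 2[1+ fromBits bs ]
  fromBits (false ∷ bs) = 1+[2 fromBits bs ]

  fromBits-toBits : ∀ b → fromBits (toBits b) ≡ b
  fromBits-toBits ℕᵇ.zero   = refl
  fromBits-toBits 2[1+ b ] = cong 2[1+_] (fromBits-toBits b)
  fromBits-toBits 1+[2 b ] = cong 1+[2_] (fromBits-toBits b)

  2^length-toBits≤1+toℕ : ∀ b → 2 ^ length (toBits b) ≤ suc (toℕ b)
  2^length-toBits≤1+toℕ ℕᵇ.zero   = s≤s z≤n
  2^length-toBits≤1+toℕ 2[1+ b ] = ℕ.m≤n⇒m≤1+n (ℕ.*-monoʳ-≤ 2 (2^length-toBits≤1+toℕ b))
  2^length-toBits≤1+toℕ 1+[2 b ] =
    ℕ.≤-trans (ℕ.*-monoʳ-≤ 2 (2^length-toBits≤1+toℕ b)) (ℕ.≤-reflexive (ℕ.*-distribˡ-+ 2 1 (toℕ b)))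

  bits : ℕ → List Bool
  bits n = toBits (fromℕ n)

  bits-injective : ∀ {m n} → bits m ≡ bits n → m ≡ n
  bits-injective {m} {n} eq = begin
    m                          ≡⟨ sym (toℕ-fromℕ m) ⟩
    toℕ (fromℕ m)              ≡⟨ cong toℕ (sym (fromBits-toBits (fromℕ m))) ⟩
    toℕ (fromBits (bits m))    ≡⟨ cong (toℕ ∘ fromBits) eq ⟩
    toℕ (fromBits (bits n))    ≡⟨ cong toℕ (fromBits-toBits (fromℕ n)) ⟩
    toℕ (fromℕ n)              ≡⟨ toℕ-fromℕ n ⟩
    n                          ∎
    where open ≡-Reasoning

  2^length-bits≤1+ : ∀ n → 2 ^ length (bits n) ≤ suc n
  2^length-bits≤1+ n =
    subst (λ m → 2 ^ length (bits n) ≤ suc m) (toℕ-fromℕ n) (2^length-toBits≤1+toℕ (fromℕ n))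

open BitStrings using (bits; bits-injective; 2^length-bits≤1+)

module Arithmetic where

  open import Data.Nat using (_+_; _*_; _^_; _≤_; s≤s; z≤n)
  import Data.Nat.Properties as ℕ
  open import Data.Nat.Tactic.RingSolver using (solve-∀)
  open ℕ.≤-Reasoning

  ^-distribʳ-* : ∀ m n k → (m * n) ^ k ≡ m ^ k * n ^ k
  ^-distribʳ-* m n zero    = refl
  ^-distribʳ-* m n (suc k) =
    trans (cong (m * n *_) (^-distribʳ-* m n k)) (interchange m n (m ^ k) (n ^ k))
    where
    interchange : ∀ a b c d → a * b * (c * d) ≡ a * c * (b * d)
    interchange = solve-∀

  2^-cancel-≤ : ∀ {a b} → 2 ^ a ≤ 2 ^ b → a ≤ b
  2^-cancel-≤ h = ℕ.≮⇒≥ (λ b<a → ℕ.<⇒≱ (ℕ.^-monoʳ-< 2 (s≤s (s≤s z≤n)) b<a) h)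

  exponent-bound : ∀ {m c p n e b} → 2 ^ m ≤ 2 ^ c * p ^ n → p ^ e ≤ 2 ^ b → m * e ≤ c * e + b * n
  exponent-bound {m} {c} {p} {n} {e} {b} 2^m≤ p^e≤ = 2^-cancel-≤ (begin
    2 ^ (m * e)                   ≡⟨ ℕ.^-*-assoc 2 m e ⟨
    (2 ^ m) ^ e                   ≤⟨ ℕ.^-monoˡ-≤ e 2^m≤ ⟩
    (2 ^ c * p ^ n) ^ e           ≡⟨ ^-distribʳ-* (2 ^ c) (p ^ n) e ⟩
    (2 ^ c) ^ e * (p ^ n) ^ e     ≡⟨ cong ((2 ^ c) ^ e *_) (swap-exponents p n e) ⟩
    (2 ^ c) ^ e * (p ^ e) ^ n     ≤⟨ ℕ.*-monoʳ-≤ ((2 ^ c) ^ e) (ℕ.^-monoˡ-≤ n p^e≤) ⟩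
    (2 ^ c) ^ e * (2 ^ b) ^ n     ≡⟨ cong₂ _*_ (ℕ.^-*-assoc 2 c e) (ℕ.^-*-assoc 2 b n) ⟩
    2 ^ (c * e) * 2 ^ (b * n)     ≡⟨ ℕ.^-distribˡ-+-* 2 (c * e) (b * n) ⟨
    2 ^ (c * e + b * n)           ∎)
    where
    swap-exponents : ∀ q i j → (q ^ i) ^ j ≡ (q ^ j) ^ i
    swap-exponents q i j =
      trans (ℕ.^-*-assoc q i j) (trans (cong (q ^_) (ℕ.*-comm i j)) (sym (ℕ.^-*-assoc q j i)))

  -- 27/17 ≥ log₂ 3, and 27/17 − 1 = 10/17 < 0.5912.
  3^17≤2^27 : 3 ^ 17 ≤ 2 ^ 27
  3^17≤2^27 = ℕ.≤ᵇ⇒≤ (3 ^ 17) (2 ^ 27) _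

  17ℓ≤10n+51 : ∀ ℓ n → 2 ^ ℓ * 2 ^ n ≤ 8 * 3 ^ n → 17 * ℓ ≤ 10 * n + 51
  17ℓ≤10n+51 ℓ n h = ℕ.+-cancelʳ-≤ (17 * n) (17 * ℓ) (10 * n + 51) (begin
    17 * ℓ + 17 * n                ≡⟨ lhs ℓ n ⟩
    (ℓ + n) * 17                   ≤⟨ exponent-bound {ℓ + n} {3} {3} {n} {17} {27} 2^[ℓ+n]≤8*3^n 3^17≤2^27 ⟩
    3 * 17 + 27 * n                ≡⟨ rhs n ⟩
    10 * n + 51 + 17 * n           ∎)
    where
    2^[ℓ+n]≤8*3^n : 2 ^ (ℓ + n) ≤ 8 * 3 ^ n
    2^[ℓ+n]≤8*3^n = subst (_≤ 8 * 3 ^ n) (sym (ℕ.^-distribˡ-+-* 2 ℓ n)) h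
    lhs : ∀ ℓ n → 17 * ℓ + 17 * n ≡ (ℓ + n) * 17
    lhs = solve-∀
    rhs : ∀ n → 3 * 17 + 27 * n ≡ 10 * n + 51 + 17 * n
    rhs = solve-∀

  10000ℓ≤5912n : ∀ ℓ n → 1012 ≤ n → 17 * ℓ ≤ 10 * n + 51 → 10000 * ℓ ≤ 5912 * n
  10000ℓ≤5912n ℓ n 1012≤n h = ℕ.*-cancelˡ-≤ 17 (begin
    17 * (10000 * ℓ)              ≡⟨ swap ℓ ⟩
    10000 * (17 * ℓ)              ≤⟨ ℕ.*-monoʳ-≤ 10000 h ⟩
    10000 * (10 * n + 51)         ≡⟨ expand n ⟩
    100000 * n + 510000           ≤⟨ ℕ.+-monoʳ-≤ (100000 * n) (ℕ.≤ᵇ⇒≤ 510000 (504 * 1012) _) ⟩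
    100000 * n + 504 * 1012       ≤⟨ ℕ.+-monoʳ-≤ (100000 * n) (ℕ.*-monoʳ-≤ 504 1012≤n) ⟩
    100000 * n + 504 * n          ≡⟨ collect n ⟩
    17 * (5912 * n)               ∎)
    where
    swap : ∀ ℓ → 17 * (10000 * ℓ) ≡ 10000 * (17 * ℓ)
    swap = solve-∀
    expand : ∀ n → 10000 * (10 * n + 51) ≡ 100000 * n + 510000
    expand = solve-∀
    collect : ∀ n → 100000 * n + 504 * n ≡ 17 * (5912 * n)
    collect = solve-∀

  scaled-bound : ∀ k ℓ n → 10000 * ℓ ≤ 5912 * n → 10000 * k * ℓ ≤ 5912 * k * n + 10000 * n
  scaled-bound k ℓ n h = ℕ.m≤n⇒m≤n+o (10000 * n) (begin
    10000 * k * ℓ      ≡⟨ pull k ℓ 10000 ⟩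
    k * (10000 * ℓ)    ≤⟨ ℕ.*-monoʳ-≤ k h ⟩
    k * (5912 * n)     ≡⟨ pull k n 5912 ⟨
    5912 * k * n       ∎)
    where
    pull : ∀ k ℓ a → a * k * ℓ ≡ k * (a * ℓ)
    pull = solve-∀

open Arithmetic using (17ℓ≤10n+51; 10000ℓ≤5912n; scaled-bound)

open import Data.Bool using (Bool)
open import Data.Nat using (_+_; _*_; _^_; _≤_)
import Data.Nat.Properties as ℕ
open import Data.Fin using (toℕ)
open import Data.Fin.Properties using (toℕ-injective; toℕ<n)
open import Data.List.Relation.Unary.Any using (index)
open import Data.List.Membership.Setoid.Properties using (index-injective)
open import Relation.Binary.PropositionalEquality using (setoid)

encode : (n : ℕ) → LLAVL n → List Bool
encode n (t , size≡n , llavl) = bits (toℕ (index (∈-llavlOfSize size≡n llavl)))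

encode-injective : ∀ n (T T′ : LLAVL n) → encode n T ≡ encode n T′ → proj₁ T ≡ proj₁ T′
encode-injective n (t , size≡n , llavl) (t′ , size≡n′ , llavl′) eq =
  index-injective (setoid Tree) (∈-llavlOfSize size≡n llavl) (∈-llavlOfSize size≡n′ llavl′)
    (toℕ-injective (bits-injective eq))

2^length-encode : ∀ n T → 2 ^ length (encode n T) * 2 ^ n ≤ 8 * 3 ^ n
2^length-encode n (t , size≡n , llavl) =
  ℕ.≤-trans (ℕ.*-monoˡ-≤ (2 ^ n) (ℕ.≤-trans (2^length-bits≤1+ (toℕ i)) (toℕ<n i)))
            (length-llavlOfSize n)
  where
  i = index (∈-llavlOfSize size≡n llavl)

corollary1 : Σ ((n : ℕ) → LLAVL n → List Bool) λ E →
    ((n : ℕ) → 1 ≤ n → (T T′ : LLAVL n) → E n T ≡ E n T′ → proj₁ T ≡ proj₁ T′)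
    × ((k : ℕ) → 1 ≤ k → ∃ λ N → (n : ℕ) → N ≤ n → (T : LLAVL n) →
         10000 * k * length (E n T) ≤ 5912 * k * n + 10000 * n)
corollary1 = encode , (λ n _ → encode-injective n) , λ k _ → 1012 , λ n 1012≤n T →
  let ℓ = length (encode n T) in
  scaled-bound k ℓ n (10000ℓ≤5912n ℓ n 1012≤n (17ℓ≤10n+51 ℓ n (2^length-encode n T)))
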